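{- Let $s\ge1$, $t\ge0$, let $\boldsymbol{x}_0,\boldsymbol{x}_1,\ldots$ be the points of an order 2 digital $(t,s)$-sequence over $\mathbb{F}_2$ with generating matrices $C_1,\ldots,C_s$, let $N\ge2$ with $N=2^{m_1}+\cdots+2^{m_r}$, $m_1>\cdots>m_r\ge0$, let $\boldsymbol{b}\in\mathbb{N}_0^s$ and $\boldsymbol{\ell}\in B(\boldsymbol{b})$. Then, with $c(\boldsymbol{\ell})$ as defined in the context, $$|c(\boldsymbol{\ell})|\le C_s\sum_{h=1}^r\frac{2^{m_h}}{N}\sum_{\substack{\boldsymbol{z}\in\mathbb{N}_0^s\\ \boldsymbol{\ell}\oplus\lfloor2^{\boldsymbol{z}+\nu(\boldsymbol{\ell})-\boldsymbol{1}}\rfloor\in\mathcal{D}^\ast_{m_h,s}}}2^{ -|\boldsymbol{b}|_1-|\boldsymbol{z}|_1},$$ where $C_s>0$ depends only on $s$.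
   Context: Order 2 digital $(t,s)$-sequence over $\mathbb{F}_2$: digital sequence with generating matrices $C_j=(c_{j,k,\ell})\in\mathbb{F}_2^{\mathbb{N}\times\mathbb{N}}$, $c_{j,k,\ell}=0$ for $k>2\ell$ (points $\boldsymbol{x}_n=(x_{1,n},\ldots,x_{s,n})$, $x_{j,n}=\sum_{k\ge1}(\sum_{\ell\ge1}n_{\ell-1}c_{j,k,\ell}\bmod 2)2^{ -k}$ for $n=\sum_in_i2^i$), such that for all $m>t/2$ the upper-left submatrices $C_j^{2m\times m}$, with rows $c_{j,1},\ldots,c_{j,2m}$, satisfy: for all $\nu_j\ge0$ and $1\le i_{j,\nu_j}<\cdots<i_{j,1}\le2m$ with $\sum_j\sum_{l=1}^{\min(\nu_j,2)}i_{j,l}\le2m-t$ the rows $c_{j,i_{j,l}}$ are linearly independent. Walsh functions: $\mathrm{wal}_k(x)=(-1)^{\sum_{i\ge0}\kappa_ix_{i+1}}$ for $k=\sum\kappa_i2^i$, $x=\sum_{i\ge1}x_i2^{ -i}$; $\mathrm{wal}_{\boldsymbol{k}}(\boldsymbol{x})=\prod_j\mathrm{wal}_{k_j}(x_j)$. $\mu_1(0)=0$, $\mu_1(k)=1+\lfloor\log_2k\rfloor$, $\mu_1(\boldsymbol{\ell})=\sum_j\mu_1(\ell_j)$, $\nu(\boldsymbol{\ell})=(\mu_1(\ell_j))_j$, $B(\boldsymbol{b})=\{\boldsymbol{\ell}\in\mathbb{N}_0^s:\mu_1(\ell_j)=b_j\ \forall j\}$, $|\boldsymbol{b}|_1=\sum_jb_j$.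 $\oplus$: digitwise addition mod 2 of nonnegative integers; $\boldsymbol{\ell}\oplus\lfloor2^{\boldsymbol{w}+\nu(\boldsymbol{\ell})-\boldsymbol{1}}\rfloor$ has $j$th entry $\ell_j\oplus\lfloor2^{w_j+\mu_1(\ell_j)-1}\rfloor$. For $u\subseteq\{1,\ldots,s\}$, $\boldsymbol{z}_u\in\mathbb{N}^{|u|}$, $(\boldsymbol{z}_u,\boldsymbol{0})\in\mathbb{N}_0^s$ has entries $z_j$ ($j\in u$), $0$ otherwise. Coefficient: $c(\boldsymbol{\ell})=\sum_{u\in A(\boldsymbol{\ell})}(-1)^{s-|u|}\sum_{\boldsymbol{z}_u\in\mathbb{N}^{|u|}}2^{ -\mu_1(\boldsymbol{\ell})-|\boldsymbol{z}_u|_1-s}\frac1N\sum_{n=0}^{N-1}\mathrm{wal}_{\boldsymbol{\ell}\oplus\lfloor2^{(\boldsymbol{z}_u,\boldsymbol{0})+\nu(\boldsymbol{\ell})-\boldsymbol{1}}\rfloor}(\boldsymbol{x}_n)$, where $A(\boldsymbol{\ell})$ is the set of all subsets of $\{1,\ldots,s\}$ except that $\emptyset$ is excluded when every $\ell_j$ is $0$ or a power of $2$. Dual net: for $m\ge0$ and $k\in\mathbb{N}_0$ with binary digits $\kappa_0,\kappa_1,\ldots$ let $\vec{k}=(\kappa_0,\ldots,\kappa_{2m-1})^\top\in\mathbb{F}_2^{2m}$; $\mathcal{D}_{m,s}=\{\boldsymbol{k}\in\mathbb{N}_0^s:\sum_{j=1}^s(C_j^{2m\times m})^\top\vec{k}_j=\vec{0}\in\mathbb{F}_2^m\}$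 and $\mathcal{D}^\ast_{m,s}=\mathcal{D}_{m,s}\setminus\{\boldsymbol{0}\}$. -}

module Defs where

open import Data.Bool using (Bool; true; false; _∧_; _xor_; not; if_then_else_; T)
open import Data.Nat as ℕ using (ℕ; zero; suc; _+_; _*_; _∸_; _^_; _≡ᵇ_; ⌊_/2⌋)
open import Data.Nat.Logarithm using (⌊log₂_⌋)
open import Data.List as L using (List; []; _∷_; map; foldr; upTo; concatMap; take; filter)
open import Data.Nat.ListAction using (sum)
open import Data.Bool.ListAction using (any; all)
open import Data.List.Relation.Unary.Linked using (Linked)
open import Data.List.Membership.Propositional using (_∈_)
open import Data.Vec as V using (Vec; []; _∷_; lookup; toList; zipWith)
open import Data.Fin using (Fin)
open import Data.Integer using (+_)
open import Data.Rational as Q using (ℚ; 0ℚ; 1ℚ; ½)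
open import Relation.Binary.PropositionalEquality using (_≡_)
open import Data.Product using (_×_)
open import Data.Bool.Properties using (T?)

parity : ℕ → Bool
parity zero = false
parity (suc zero) = true
parity (suc (suc n)) = parity n

bit : ℕ → ℕ → Bool
bit n zero = parity n
bit n (suc i) = bit ⌊ n /2⌋ i

b2n : Bool → ℕ
b2n true = 1
b2n false = 0

⊕L : List Bool → Bool
⊕L = foldr _xor_ false

-- digitwise addition mod 2 (all digits of index ≥ a + b are 0 in both)
_⊕_ : ℕ → ℕ → ℕ
a ⊕ b = sum (map (λ i → b2n (bit a i xor bit b i) * 2 ^ i) (upTo (a + b)))

μ₁ : ℕ → ℕ
μ₁ zero = 0
μ₁ k@(suc _) = suc ⌊log₂ k ⌋

μ₁v : ∀ {s} → Vec ℕ s → ℕ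
μ₁v ℓ = sum (toList (V.map μ₁ ℓ))

∣_∣₁ : ∀ {s} → Vec ℕ s → ℕ
∣ z ∣₁ = sum (toList z)

InB : ∀ {s} → Vec ℕ s → Vec ℕ s → Set
InB {s} b ℓ = (j : Fin s) → μ₁ (lookup ℓ j) ≡ lookup b j

-- ⌊ 2^(w + μ₁(ℓ) - 1) ⌋  (equals 0 when w + μ₁(ℓ) = 0, since ⌊2^{-1}⌋ = 0)
floorPow : ℕ → ℕ
floorPow zero = 0
floorPow (suc e) = 2 ^ e

-- the j-th entry of  ℓ ⊕ ⌊2^{w + ν(ℓ) - 1}⌋
shiftEntry : ℕ → ℕ → ℕ
shiftEntry w ℓ = ℓ ⊕ floorPow (w + μ₁ ℓ)

shiftIdx : ∀ {s} → Vec ℕ s → Vec ℕ s → Vec ℕ s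
shiftIdx w ℓ = zipWith shiftEntry w ℓ

-- Generating matrices over F₂.  Convention: C j k l is the entry
-- c_{j,k,l} of the paper (1-based: k, l ≥ 1; values at index 0 unused).

Mats : ℕ → Set
Mats s = Fin s → ℕ → ℕ → Bool

-- k-th digit (k ≥ 1) of x_{j,n}:  Σ_{l ≥ 1} n_{l-1} c_{j,k,l} mod 2.
-- Only l ≤ n can contribute, since n_{i} = 0 for i ≥ n (n < 2^n).
xdigit : ∀ {s} → Mats s → Fin s → ℕ → ℕ → Bool
xdigit C j n k = ⊕L (map (λ l → bit n l ∧ C j k (suc l)) (upTo n))

-- exponent parity of wal_k(x_{j,n}) = (-1)^{Σ_{i≥0} κ_i x_{j,n,i+1}}
-- (κ_i = 0 for i ≥ k)
walBit : ∀ {s} → Mats s → Fin s → ℕ → ℕ → Bool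
walBit C j k n = ⊕L (map (λ i → bit k i ∧ xdigit C j n (suc i)) (upTo k))

sign : Bool → ℚ
sign false = 1ℚ
sign true = Q.- 1ℚ

wal : ∀ {s} → Mats s → Vec ℕ s → ℕ → ℚ
wal {s} C k n = sign (⊕L (toList (V.tabulate (λ j → walBit C j (lookup k j) n))))

sumℚ : List ℚ → ℚ
sumℚ = foldr Q._+_ 0ℚ

inv : ℕ → ℚ
inv zero = 0ℚ
inv (suc n) = + 1 Q./ suc n

avgWal : ∀ {s} → Mats s → ℕ → Vec ℕ s → ℚ
avgWal C N k = inv N Q.* sumℚ (map (wal C k) (upTo N))

half^ : ℕ → ℚ
half^ zero = 1ℚ
half^ (suc e) = ½ Q.* half^ e

-- coefficients a j i (for row i of C_j) give the zero combination of the
-- rows c_{j,i} (i ∈ I j) of the 2m × m submatrices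
ZeroComb : ∀ {s} → Mats s → ℕ → (Fin s → List ℕ) → (Fin s → ℕ → Bool) → Set
ZeroComb {s} C m I a = (l : ℕ) → 1 ℕ.≤ l → l ℕ.≤ m →
  ⊕L (L.concat (toList (V.tabulate (λ j → map (λ i → a j i ∧ C j i l) (I j))))) ≡ false

RowsIndependent : ∀ {s} → Mats s → ℕ → (Fin s → List ℕ) → Set
RowsIndependent {s} C m I = (a : Fin s → ℕ → Bool) → ZeroComb C m I a →
  (j : Fin s) → (i : ℕ) → i ∈ I j → a j i ≡ false

weight : ∀ {s} → (Fin s → List ℕ) → ℕ
weight {s} I = sum (toList (V.tabulate (λ j → sum (take 2 (I j)))))

IsOrder2Seq : (s t : ℕ) → Mats s → Set
IsOrder2Seq s t C =
  ((j : Fin s) (k l : ℕ) → 2 * l ℕ.< k → C j k l ≡ false) ×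
  ((m : ℕ) → t ℕ.< 2 * m →
   (I : Fin s → List ℕ) →
   ((j : Fin s) → Linked ℕ._>_ (I j)) →
   ((j : Fin s) (i : ℕ) → i ∈ I j → 1 ℕ.≤ i × i ℕ.≤ 2 * m) →
   weight I ℕ.≤ 2 * m ∸ t →
   RowsIndependent C m I)

-- Dual net  D_{m,s}:  Σ_j (C_j^{2m×m})^T k⃗_j = 0 ∈ F₂^m

inDualB : ∀ {s} → Mats s → ℕ → Vec ℕ s → Bool
inDualB {s} C m k =
  all (λ l → not (⊕L (L.concat (toList (V.tabulate (λ j →
           map (λ r → bit (lookup k j) r ∧ C j (suc r) l) (upTo (2 * m))))))))
        (map suc (upTo m))

isZeroVecB : ∀ {s} → Vec ℕ s → Bool
isZeroVecB k = all (λ x → x ≡ᵇ 0) (toList k)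

inDualStarB : ∀ {s} → Mats s → ℕ → Vec ℕ s → Bool
inDualStarB C m k = inDualB C m k ∧ not (isZeroVecB k)

-- all subsets u ⊆ {1,…,s} as characteristic vectors
subsets : (s : ℕ) → List (Vec Bool s)
subsets zero = [] ∷ []
subsets (suc s) = concatMap (λ u → (false ∷ u) ∷ (true ∷ u) ∷ []) (subsets s)

countU : ∀ {s} → Vec Bool s → ℕ
countU u = sum (toList (V.map b2n u))

boxU : ∀ {s} → Vec Bool s → ℕ → List (Vec ℕ s)
boxU [] K = [] ∷ []
boxU (false ∷ u) K = map (0 ∷_) (boxU u K)
boxU (true ∷ u) K = concatMap (λ z → map (λ v → z ∷ v) (boxU u K)) (map suc (upTo K))

box0 : (s : ℕ) → ℕ → List (Vec ℕ s)
box0 zero K = [] ∷ []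
box0 (suc s) K = concatMap (λ z → map (λ v → z ∷ v) (box0 s K)) (upTo (suc K))

-- ℓ_j is 0 or a power of 2 (a power 2^e of 2 with 2^e = ℓ forces e < ℓ + 1)
zeroOrPow2 : ℕ → Bool
zeroOrPow2 ℓ = (ℓ ≡ᵇ 0) Data.Bool.∨ any (λ e → 2 ^ e ≡ᵇ ℓ) (upTo (suc ℓ))

inA : ∀ {s} → Vec ℕ s → Vec Bool s → Bool
inA ℓ u = not (isZeroVecB (V.map b2n u) ∧ all zeroOrPow2 (toList ℓ))

signU : ℕ → ℚ
signU zero = 1ℚ
signU (suc e) = Q.- signU e

-- partial sum of c(ℓ): the inner series over z_u ∈ ℕ^{|u|} truncated to z_j ≤ K
cPartial : ∀ {s} → Mats s → ℕ → Vec ℕ s → ℕ → ℚ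
cPartial {s} C N ℓ K =
  sumℚ (map (λ u → signU (s ∸ countU u) Q.*
          sumℚ (map (λ z → half^ (μ₁v ℓ + ∣ z ∣₁ + s) Q.* avgWal C N (shiftIdx z ℓ))
                    (boxU u K)))
        (filter (λ u → T? (inA ℓ u)) (subsets s)))

rhsInner : ∀ {s} → Mats s → ℕ → Vec ℕ s → Vec ℕ s → ℕ → ℚ
rhsInner {s} C m b ℓ K =
  sumℚ (map (λ z → if inDualStarB C m (shiftIdx z ℓ) then half^ (∣ b ∣₁ + ∣ z ∣₁) else 0ℚ)
            (box0 s K))

rhsPartial : ∀ {s} → Mats s → ℕ → List ℕ → Vec ℕ s → Vec ℕ s → ℕ → ℚ
rhsPartial C N ms b ℓ K =
  sumℚ (map (λ m → ((+ (2 ^ m)) Q./ 1) Q.* inv N Q.* rhsInner C m b ℓ K) ms)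

-- By the definition of a digital sequence, wal_k(x_n) = (-1)^⟨n⃗, Σ_j C_jᵀ k⃗_j⟩, so n ↦ wal_k(x_n)
-- is a character of the binary digits of n.  Split {0, …, N-1} into consecutive blocks of
-- lengths 2^{m_1}, …, 2^{m_r}; each block starts at a multiple of its length.  Over such a block
-- of length 2^m the character sum vanishes unless the first m entries of Σ_j C_jᵀ k⃗_j vanish,
-- i.e. unless k ∈ D_{m,s}; otherwise it is at most 2^m.  For u ∈ A(ℓ) and z supported exactly
-- on u the index ℓ ⊕ ⌊2^{z+ν(ℓ)-1}⌋ is nonzero, so every Walsh average in c(ℓ) is bounded by
-- the D*-sum of the right-hand side; summing over the subsets u gives C_s = number of subsets
-- of {1, …, s}.
module Submission where

open import Defs
open import Algebra.Bundles using (CommutativeRing)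
open import Algebra.Core using (Op₂)
open import Algebra.Structures using (IsCommutativeSemiring; IsCommutativeRing)
open import Data.Bool using (Bool; true; false; not; _∧_; _∨_; _xor_; if_then_else_; T)
open import Data.Bool.ListAction using (all; any)
open import Data.Bool.Properties using (xor-∧-commutativeRing; ∧-zeroʳ; ∨-zeroʳ; T-≡; T?)
open import Data.Fin as Fin using (Fin)
import Data.Integer as ℤ
open import Data.List as List using (List; []; _∷_; _++_; map; concat; concatMap; upTo; applyUpTo; filter)
open import Data.List.Membership.Propositional using (_∈_)
open import Data.List.Membership.Propositional.Properties using (∈-map⁺; ∈-map⁻; ∈-upTo⁺; ∈-upTo⁻)
open import Data.List.Properties using (map-∘; map-cong; map-cong-local; concat-map; map-applyUpTo; map-upTo)
open import Data.List.Relation.Unary.All as All using (All; []; _∷_)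
open import Data.List.Relation.Unary.All.Properties using (applyUpTo⁺₁; all-filter)
open import Data.List.Relation.Unary.AllPairs using (AllPairs; []; _∷_)
open import Data.List.Relation.Unary.Any using (here; there)
open import Data.List.Relation.Unary.Linked using (Linked)
open import Data.List.Relation.Unary.Linked.Properties using (Linked⇒AllPairs)
open import Data.Nat as ℕ using (ℕ; zero; suc; _^_; _≡ᵇ_; ⌊_/2⌋; z≤n; s≤s)
import Data.Nat.Coprimality as Coprimality
import Data.Nat.Divisibility as ℕ
open import Data.Nat.ListAction using (sum)
open import Data.Nat.Logarithm using (⌊log₂_⌋; ⌊log₂[2^n]⌋≡n)
import Data.Nat.Properties as ℕ
open import Data.Nat.Tactic.RingSolver using (solve-∀)
open import Data.Product using (Σ; ∃; ∃₂; _×_; _,_; proj₁)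
open import Data.Rational as Q using (ℚ; 0ℚ; 1ℚ; ½; ∣_∣; _+_; _*_; _≤_; _<_)
open import Data.Rational.Properties
open import Data.Sum using (inj₁; inj₂)
open import Data.Unit using (⊤)
open import Data.Vec as Vec using (Vec; []; _∷_; lookup; toList; tabulate; allFin)
open import Data.Vec.Properties using (tabulate-allFin; toList-map)
open import Function using (_∘_; flip; Equivalence)
open import Relation.Binary.PropositionalEquality using (_≡_; _≢_; refl; sym; trans; cong; cong₂; subst; module ≡-Reasoning)
open import Relation.Nullary using (does; yes; no; contradiction)
open import Relation.Unary using (Decidable)

module FiniteSums {A : Set} {_+_ _*_ : Op₂ A} {0# 1# : A}
                  (isCommutativeSemiring : IsCommutativeSemiring _≡_ _+_ _*_ 0# 1#) where

  private module R = IsCommutativeSemiring isCommutativeSemiring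
  open ≡-Reasoning

  ∑ : List A → A
  ∑ = List.foldr _+_ 0#

  ∑-++ : ∀ xs ys → ∑ (xs ++ ys) ≡ ∑ xs + ∑ ys
  ∑-++ []       ys = sym (R.+-identityˡ (∑ ys))
  ∑-++ (x ∷ xs) ys = trans (cong (x +_) (∑-++ xs ys)) (sym (R.+-assoc x (∑ xs) (∑ ys)))

  ∑-concat : ∀ xss → ∑ (concat xss) ≡ ∑ (map ∑ xss)
  ∑-concat []         = refl
  ∑-concat (xs ∷ xss) = trans (∑-++ xs (concat xss)) (cong (∑ xs +_) (∑-concat xss))

  ∑-concatMap : ∀ {B C : Set} (f : C → A) (g : B → List C) xs →
                ∑ (map f (concatMap g xs)) ≡ ∑ (map (λ x → ∑ (map f (g x))) xs)
  ∑-concatMap f g xs = begin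
    ∑ (map f (concat (map g xs)))         ≡⟨ cong ∑ (concat-map (map g xs)) ⟨
    ∑ (concat (map (map f) (map g xs)))   ≡⟨ ∑-concat (map (map f) (map g xs)) ⟩
    ∑ (map ∑ (map (map f) (map g xs)))    ≡⟨ cong (∑ ∘ map ∑) (map-∘ xs) ⟨
    ∑ (map ∑ (map (map f ∘ g) xs))        ≡⟨ cong ∑ (map-∘ xs) ⟨
    ∑ (map (λ x → ∑ (map f (g x))) xs)    ∎

  ∑-map-zero : ∀ {B : Set} (xs : List B) → ∑ (map (λ _ → 0#) xs) ≡ 0#
  ∑-map-zero []       = refl
  ∑-map-zero (x ∷ xs) = trans (R.+-identityˡ _) (∑-map-zero xs)

  ∑-map-+ : ∀ {B : Set} (f g : B → A) xs →
            ∑ (map (λ x → f x + g x) xs) ≡ ∑ (map f xs) + ∑ (map g xs)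
  ∑-map-+ f g []       = sym (R.+-identityˡ 0#)
  ∑-map-+ f g (x ∷ xs) = begin
    (f x + g x) + ∑ (map (λ x → f x + g x) xs)   ≡⟨ cong ((f x + g x) +_) (∑-map-+ f g xs) ⟩
    (f x + g x) + (F + G)                         ≡⟨ R.+-assoc (f x) (g x) (F + G) ⟩
    f x + (g x + (F + G))                         ≡⟨ cong (f x +_) (R.+-assoc (g x) F G) ⟨
    f x + ((g x + F) + G)                         ≡⟨ cong (λ y → f x + (y + G)) (R.+-comm (g x) F) ⟩
    f x + ((F + g x) + G)                         ≡⟨ cong (f x +_) (R.+-assoc F (g x) G) ⟩
    f x + (F + (g x + G))                         ≡⟨ R.+-assoc (f x) F (g x + G) ⟨
    (f x + F) + (g x + G)                         ∎
    where F = ∑ (map f xs); G = ∑ (map g xs)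

  *-∑ : ∀ {B : Set} c (f : B → A) xs → c * ∑ (map f xs) ≡ ∑ (map (λ x → c * f x) xs)
  *-∑ c f []       = R.zeroʳ c
  *-∑ c f (x ∷ xs) = trans (R.distribˡ c (f x) _) (cong ((c * f x) +_) (*-∑ c f xs))

  ∑-map-const : ∀ {B : Set} c (xs : List B) → ∑ (map (λ _ → c) xs) ≡ ∑ (map (λ _ → 1#) xs) * c
  ∑-map-const c []       = sym (R.zeroˡ c)
  ∑-map-const c (x ∷ xs) = trans (cong₂ _+_ (sym (R.*-identityˡ c)) (∑-map-const c xs))
                                 (sym (R.distribʳ c 1# (∑ (map (λ _ → 1#) xs))))

  ∑-map-swap : ∀ {B C : Set} (f : B → C → A) xs ys →
               ∑ (map (λ x → ∑ (map (f x) ys)) xs) ≡ ∑ (map (λ y → ∑ (map (λ x → f x y) xs)) ys)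
  ∑-map-swap f []       ys = sym (∑-map-zero ys)
  ∑-map-swap f (x ∷ xs) ys = trans (cong (∑ (map (f x) ys) +_) (∑-map-swap f xs ys))
    (sym (∑-map-+ (f x) (λ y → ∑ (map (λ x′ → f x′ y) xs)) ys))

  private
    *-leftComm : ∀ x y z → x * (y * z) ≡ y * (x * z)
    *-leftComm x y z = begin
      x * (y * z)  ≡⟨ R.*-assoc x y z ⟨
      (x * y) * z  ≡⟨ cong (_* z) (R.*-comm x y) ⟩
      (y * x) * z  ≡⟨ R.*-assoc y x z ⟩
      y * (x * z)  ∎

  ∑-transpose : ∀ {B C : Set} (a : B → A) (b : C → A) (M : B → C → A) xs ys →
    ∑ (map (λ x → a x * ∑ (map (λ y → b y * M x y) ys)) xs) ≡
    ∑ (map (λ y → b y * ∑ (map (λ x → a x * M x y) xs)) ys)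
  ∑-transpose a b M xs ys = begin
    ∑ (map (λ x → a x * ∑ (map (λ y → b y * M x y) ys)) xs)
      ≡⟨ cong ∑ (map-cong pull-in xs) ⟩
    ∑ (map (λ x → ∑ (map (λ y → b y * (a x * M x y)) ys)) xs)
      ≡⟨ ∑-map-swap (λ x y → b y * (a x * M x y)) xs ys ⟩
    ∑ (map (λ y → ∑ (map (λ x → b y * (a x * M x y)) xs)) ys)
      ≡⟨ cong ∑ (map-cong (λ y → *-∑ (b y) (λ x → a x * M x y) xs) ys) ⟨
    ∑ (map (λ y → b y * ∑ (map (λ x → a x * M x y) xs)) ys) ∎
    where
    pull-in : ∀ x → a x * ∑ (map (λ y → b y * M x y) ys) ≡ ∑ (map (λ y → b y * (a x * M x y)) ys)
    pull-in x = trans (*-∑ (a x) (λ y → b y * M x y) ys) (cong ∑ (map-cong (λ y → *-leftComm (a x) (b y) (M x y)) ys))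

  ∑< : ℕ → (ℕ → A) → A
  ∑< n f = ∑ (map f (upTo n))

  ∑<-suc : ∀ n f → ∑< (suc n) f ≡ f 0 + ∑< n (f ∘ suc)
  ∑<-suc n f = cong (λ xs → f 0 + ∑ xs) (begin
    map f (applyUpTo suc n)  ≡⟨ map-applyUpTo suc f n ⟩
    applyUpTo (f ∘ suc) n    ≡⟨ map-upTo (f ∘ suc) n ⟨
    map (f ∘ suc) (upTo n)   ∎)

  ∑<-cong : ∀ n {f g : ℕ → A} → (∀ {i} → i ℕ.< n → f i ≡ g i) → ∑< n f ≡ ∑< n g
  ∑<-cong n f≡g = cong ∑ (map-cong-local (applyUpTo⁺₁ (λ i → i) n f≡g))

  ∑<-split : ∀ m n f → ∑< (m ℕ.+ n) f ≡ ∑< m f + ∑< n (λ i → f (m ℕ.+ i))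
  ∑<-split zero    n f = sym (R.+-identityˡ (∑< n f))
  ∑<-split (suc m) n f = begin
    ∑< (suc m ℕ.+ n) f
      ≡⟨ ∑<-suc (m ℕ.+ n) f ⟩
    f 0 + ∑< (m ℕ.+ n) (f ∘ suc)
      ≡⟨ cong (f 0 +_) (∑<-split m n (f ∘ suc)) ⟩
    f 0 + (∑< m (f ∘ suc) + ∑< n (λ i → f (suc m ℕ.+ i)))
      ≡⟨ R.+-assoc (f 0) _ _ ⟨
    (f 0 + ∑< m (f ∘ suc)) + ∑< n (λ i → f (suc m ℕ.+ i))
      ≡⟨ cong (_+ ∑< n (λ i → f (suc m ℕ.+ i))) (∑<-suc m f) ⟨
    ∑< (suc m) f + ∑< n (λ i → f (suc m ℕ.+ i)) ∎

  ∑<-extend : ∀ {m n} f → (∀ {i} → m ℕ.≤ i → f i ≡ 0#) → m ℕ.≤ n → ∑< m f ≡ ∑< n f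
  ∑<-extend {m} {n} f tail≡0 m≤n = begin
    ∑< m f
      ≡⟨ R.+-identityʳ (∑< m f) ⟨
    ∑< m f + 0#
      ≡⟨ cong (∑< m f +_) (∑-map-zero (upTo (n ℕ.∸ m))) ⟨
    ∑< m f + ∑< (n ℕ.∸ m) (λ _ → 0#)
      ≡⟨ cong (∑< m f +_) (cong ∑ (map-cong (λ i → sym (tail≡0 (ℕ.m≤m+n m i))) (upTo (n ℕ.∸ m)))) ⟩
    ∑< m f + ∑< (n ℕ.∸ m) (λ i → f (m ℕ.+ i))
      ≡⟨ ∑<-split m (n ℕ.∸ m) f ⟨
    ∑< (m ℕ.+ (n ℕ.∸ m)) f
      ≡⟨ cong (λ k → ∑< k f) (ℕ.m+[n∸m]≡n m≤n) ⟩
    ∑< n f ∎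

  ∑<-pairs : ∀ n f → ∑< (2 ℕ.* n) f ≡ ∑< n (λ i → f (2 ℕ.* i) + f (suc (2 ℕ.* i)))
  ∑<-pairs zero    f = refl
  ∑<-pairs (suc n) f = begin
    ∑< (2 ℕ.* suc n) f                                ≡⟨ cong (λ k → ∑< k f) (ℕ.*-suc 2 n) ⟩
    ∑< (2 ℕ.+ 2 ℕ.* n) f                              ≡⟨ ∑<-split 2 (2 ℕ.* n) f ⟩
    (f 0 + (f 1 + 0#)) + ∑< (2 ℕ.* n) (λ i → f (2 ℕ.+ i))
      ≡⟨ cong₂ _+_ (cong (f 0 +_) (R.+-identityʳ (f 1))) (∑<-pairs n (λ i → f (2 ℕ.+ i))) ⟩
    (f 0 + f 1) + ∑< n (λ i → f (2 ℕ.+ 2 ℕ.* i) + f (3 ℕ.+ 2 ℕ.* i))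
      ≡⟨ cong ((f 0 + f 1) +_) (cong ∑ (map-cong (λ i → cong (λ j → f j + f (suc j)) (ℕ.*-suc 2 i)) (upTo n))) ⟨
    (f 0 + f 1) + ∑< n (λ i → f (2 ℕ.* suc i) + f (suc (2 ℕ.* suc i)))
      ≡⟨ ∑<-suc n (λ i → f (2 ℕ.* i) + f (suc (2 ℕ.* i))) ⟨
    ∑< (suc n) (λ i → f (2 ℕ.* i) + f (suc (2 ℕ.* i)))  ∎

module F₂ = FiniteSums (CommutativeRing.isCommutativeSemiring xor-∧-commutativeRing)
open FiniteSums (IsCommutativeRing.isCommutativeSemiring +-*-isCommutativeRing)

*-monoˡ-≤-0≤ : ∀ {c p q} → 0ℚ ≤ c → p ≤ q → c * p ≤ c * q
*-monoˡ-≤-0≤ {c} 0≤c = *-monoˡ-≤-nonNeg c {{Q.nonNegative 0≤c}}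

0≤p*q : ∀ {p q} → 0ℚ ≤ p → 0ℚ ≤ q → 0ℚ ≤ p * q
0≤p*q {p} 0≤p 0≤q = ≤-trans (≤-reflexive (sym (*-zeroʳ p))) (*-monoˡ-≤-0≤ 0≤p 0≤q)

p≤p+q : ∀ {p q} → 0ℚ ≤ q → p ≤ p + q
p≤p+q {p} 0≤q = ≤-trans (≤-reflexive (sym (+-identityʳ p))) (+-monoʳ-≤ p 0≤q)

p≤q+p : ∀ {p q} → 0ℚ ≤ q → p ≤ q + p
p≤q+p {p} {q} 0≤q = ≤-trans (p≤p+q 0≤q) (≤-reflexive (+-comm p q))

∣∑∣≤∑∣∣ : ∀ {A : Set} (f : A → ℚ) xs → ∣ ∑ (map f xs) ∣ ≤ ∑ (map (∣_∣ ∘ f) xs)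
∣∑∣≤∑∣∣ f []       = ≤-refl
∣∑∣≤∑∣∣ f (x ∷ xs) = ≤-trans (∣p+q∣≤∣p∣+∣q∣ (f x) (∑ (map f xs))) (+-monoʳ-≤ ∣ f x ∣ (∣∑∣≤∑∣∣ f xs))

∑-map-mono : ∀ {A : Set} {f g : A → ℚ} {xs} → All (λ x → f x ≤ g x) xs → ∑ (map f xs) ≤ ∑ (map g xs)
∑-map-mono []         = ≤-refl
∑-map-mono (fx≤gx ∷ h) = +-mono-≤ fx≤gx (∑-map-mono h)

∑-map-nonNeg : ∀ {A : Set} {f : A → ℚ} → (∀ x → 0ℚ ≤ f x) → ∀ xs → 0ℚ ≤ ∑ (map f xs)
∑-map-nonNeg 0≤f []       = ≤-refl
∑-map-nonNeg 0≤f (x ∷ xs) = +-mono-≤ (0≤f x) (∑-map-nonNeg 0≤f xs)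

∑-map-filter-≤ : ∀ {A : Set} {P : A → Set} (P? : Decidable P) {f : A → ℚ} → (∀ x → 0ℚ ≤ f x) →
                 ∀ xs → ∑ (map f (filter P? xs)) ≤ ∑ (map f xs)
∑-map-filter-≤ P?     0≤f []       = ≤-refl
∑-map-filter-≤ P? {f} 0≤f (x ∷ xs) with does (P? x)
... | true  = +-monoʳ-≤ (f x) (∑-map-filter-≤ P? 0≤f xs)
... | false = ≤-trans (∑-map-filter-≤ P? 0≤f xs) (p≤q+p (0≤f x))

private
  1+n/1≡suc-n/1 : ∀ n → 1ℚ + ℤ.+ n Q./ 1 ≡ ℤ.+ suc n Q./ 1
  1+n/1≡suc-n/1 zero    = refl
  1+n/1≡suc-n/1 (suc n) rewrite normalize-coprime (Coprimality.sym (Coprimality.1-coprimeTo (suc n))) =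
    normalize-cong {suc (suc (n ℕ.* 1))} {1} {suc (suc n)} {1} (cong (suc ∘ suc) (ℕ.*-identityʳ n)) refl

∑<-one : ∀ n → ∑< n (λ _ → 1ℚ) ≡ ℤ.+ n Q./ 1
∑<-one zero    = refl
∑<-one (suc n) = trans (∑<-suc n (λ _ → 1ℚ)) (trans (cong (1ℚ +_) (∑<-one n)) (1+n/1≡suc-n/1 n))

∣∑<∣≤n : ∀ n (f : ℕ → ℚ) → (∀ i → ∣ f i ∣ ≡ 1ℚ) → ∣ ∑< n f ∣ ≤ ℤ.+ n Q./ 1
∣∑<∣≤n n f ∣f∣≡1 = ≤-trans (∣∑∣≤∑∣∣ f (upTo n))
  (≤-reflexive (trans (cong ∑ (map-cong ∣f∣≡1 (upTo n))) (∑<-one n)))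

⌊n/2⌋≤m : ∀ {n m} → n ℕ.≤ suc m → ⌊ n /2⌋ ℕ.≤ m
⌊n/2⌋≤m {m = m} n≤1+m = ℕ.≤-pred (ℕ.≤-<-trans (ℕ.⌊n/2⌋-mono n≤1+m) (ℕ.⌊n/2⌋<n m))

bit-beyond : ∀ n i → n ℕ.≤ i → bit n i ≡ false
bit-beyond zero    zero    _     = refl
bit-beyond n       (suc i) n≤1+i = bit-beyond ⌊ n /2⌋ i (⌊n/2⌋≤m n≤1+i)

parity-double : ∀ x → parity (x ℕ.+ x) ≡ false
parity-double zero    = refl
parity-double (suc x) rewrite ℕ.+-suc x x = parity-double x

parity-double+1 : ∀ x → parity (suc (x ℕ.+ x)) ≡ true
parity-double+1 zero    = refl
parity-double+1 (suc x) rewrite ℕ.+-suc x x = parity-double+1 x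

⌊double+1/2⌋ : ∀ x → ⌊ suc (x ℕ.+ x) /2⌋ ≡ x
⌊double+1/2⌋ zero    = refl
⌊double+1/2⌋ (suc x) rewrite ℕ.+-suc x x = cong suc (⌊double+1/2⌋ x)

parity+double-half : ∀ x → b2n (parity x) ℕ.+ (⌊ x /2⌋ ℕ.+ ⌊ x /2⌋) ≡ x
parity+double-half zero          = refl
parity+double-half (suc zero)    = refl
parity+double-half (suc (suc x)) =
  trans (shift (b2n (parity x)) ⌊ x /2⌋) (cong (suc ∘ suc) (parity+double-half x))
  where
  shift : ∀ p h → p ℕ.+ (suc h ℕ.+ suc h) ≡ suc (suc (p ℕ.+ (h ℕ.+ h)))
  shift = solve-∀

bits-injective : ∀ {x y} → (∀ i → bit x i ≡ bit y i) → x ≡ y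
bits-injective {x} {y} = go (x ℕ.+ y) (ℕ.m≤m+n x y) (ℕ.m≤n+m y x)
  where
  go : ∀ fuel {x y} → x ℕ.≤ fuel → y ℕ.≤ fuel → (∀ i → bit x i ≡ bit y i) → x ≡ y
  go zero    z≤n z≤n _ = refl
  go (suc f) {x} {y} x≤ y≤ same = begin
    x                                         ≡⟨ parity+double-half x ⟨
    b2n (parity x) ℕ.+ (⌊ x /2⌋ ℕ.+ ⌊ x /2⌋)      ≡⟨ cong₂ (λ p h → b2n p ℕ.+ (h ℕ.+ h)) (same 0) halves ⟩
    b2n (parity y) ℕ.+ (⌊ y /2⌋ ℕ.+ ⌊ y /2⌋)      ≡⟨ parity+double-half y ⟩
    y                                         ∎
    where
    open ≡-Reasoning
    halves = go f (⌊n/2⌋≤m x≤) (⌊n/2⌋≤m y≤) (same ∘ suc)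

sum≡0⇒All≡0 : ∀ ns → sum ns ≡ 0 → All (_≡ 0) ns
sum≡0⇒All≡0 []       _   = []
sum≡0⇒All≡0 (n ∷ ns) Σ≡0 = ℕ.m+n≡0⇒m≡0 n Σ≡0 ∷ sum≡0⇒All≡0 ns (ℕ.m+n≡0⇒n≡0 n Σ≡0)

⊕≡0⇒≡ : ∀ a b → a ⊕ b ≡ 0 → a ≡ b
⊕≡0⇒≡ a b a⊕b≡0 = bits-injective same
  where
  digits≡0 = sum≡0⇒All≡0 _ a⊕b≡0
  xor≡false⇒≡ : ∀ {p q} → b2n (p xor q) ≡ 0 → p ≡ q
  xor≡false⇒≡ {false} {false} _ = refl
  xor≡false⇒≡ {true}  {true}  _ = refl
  same : ∀ i → bit a i ≡ bit b i
  same i with i ℕ.<? a ℕ.+ b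
  ... | yes i<a+b = xor≡false⇒≡ (ℕ.m*n≡0⇒m≡0 _ (2 ^ i) {{ℕ.m^n≢0 2 i}}
                      (All.lookup digits≡0 (∈-map⁺ _ (∈-upTo⁺ i<a+b))))
  ... | no  i≮a+b = trans (bit-beyond a i (ℕ.≤-trans (ℕ.m≤m+n a b) a+b≤i))
                          (sym (bit-beyond b i (ℕ.≤-trans (ℕ.m≤n+m b a) a+b≤i)))
    where a+b≤i = ℕ.≮⇒≥ i≮a+b

-- Walsh functions as characters of the digits

toList-tabulate : ∀ {A : Set} {n} (f : Fin n → A) → toList (tabulate f) ≡ map f (toList (allFin n))
toList-tabulate f = trans (cong toList (tabulate-allFin f)) (toList-map f (allFin _))

-- coefficient C j k l and syndrome C k l are the entries l + 1 of C_jᵀ k⃗ and of Σ_j C_jᵀ k⃗_j,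
-- where k⃗ has all the digits of k
coefficient : ∀ {s} → Mats s → Fin s → ℕ → ℕ → Bool
coefficient C j k l = F₂.∑< k (λ i → bit k i ∧ C j (suc i) (suc l))

syndrome : ∀ {s} → Mats s → Vec ℕ s → ℕ → Bool
syndrome {s} C k l = F₂.∑ (map (λ j → coefficient C j (lookup k j) l) (toList (allFin s)))

dot : ℕ → (ℕ → Bool) → ℕ → Bool
dot L G n = F₂.∑< L (λ l → bit n l ∧ G l)

walBit≡dot : ∀ {s} (C : Mats s) j k n → walBit C j k n ≡ dot n (coefficient C j k) n
walBit≡dot C j k n = F₂.∑-transpose (bit k) (bit n) (λ i l → C j (suc i) (suc l)) (upTo k) (upTo n)

dot-extend : ∀ G {n L} → n ℕ.≤ L → dot n G n ≡ dot L G n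
dot-extend G {n} = F₂.∑<-extend (λ l → bit n l ∧ G l) (λ n≤l → cong (_∧ G _) (bit-beyond n _ n≤l))

wal≡sign-dot : ∀ {s} (C : Mats s) k {n L} → n ℕ.≤ L → wal C k n ≡ sign (dot L (syndrome C k) n)
wal≡sign-dot {s} C k {n} {L} n≤L = cong sign (begin
  F₂.∑ (toList (tabulate (λ j → walBit C j (lookup k j) n)))
    ≡⟨ cong F₂.∑ (toList-tabulate (λ j → walBit C j (lookup k j) n)) ⟩
  F₂.∑ (map (λ j → walBit C j (lookup k j) n) js)
    ≡⟨ cong F₂.∑ (map-cong (λ j → walBit≡dot C j (lookup k j) n) js) ⟩
  F₂.∑ (map (λ j → dot n (coefficient C j (lookup k j)) n) js)
    ≡⟨ F₂.∑-transpose (λ _ → true) (bit n) (λ j → coefficient C j (lookup k j)) js (upTo n) ⟩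
  dot n (syndrome C k) n
    ≡⟨ dot-extend (syndrome C k) n≤L ⟩
  dot L (syndrome C k) n ∎)
  where
  open ≡-Reasoning
  js = toList (allFin s)

dot-double : ∀ L G x → dot (suc L) G (x ℕ.+ x) ≡ dot L (G ∘ suc) x
dot-double L G x = trans (F₂.∑<-suc L (λ l → bit (x ℕ.+ x) l ∧ G l))
  (cong₂ (λ p y → (p ∧ G 0) xor dot L (G ∘ suc) y) (parity-double x) (sym (ℕ.n≡⌊n+n/2⌋ x)))

dot-double+1 : ∀ L G x → dot (suc L) G (suc (x ℕ.+ x)) ≡ G 0 xor dot L (G ∘ suc) x
dot-double+1 L G x = trans (F₂.∑<-suc L (λ l → bit (suc (x ℕ.+ x)) l ∧ G l))
  (cong₂ (λ p y → (p ∧ G 0) xor dot L (G ∘ suc) y) (parity-double+1 x) (⌊double+1/2⌋ x))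

-- Character sums over dyadic blocks

sign-cancel : ∀ b → sign b + sign (not b) ≡ 0ℚ
sign-cancel false = +-inverseʳ 1ℚ
sign-cancel true  = +-inverseˡ 1ℚ

∣sign∣≡1 : ∀ b → ∣ sign b ∣ ≡ 1ℚ
∣sign∣≡1 false = refl
∣sign∣≡1 true  = refl

-- Pairing the points 2y and 2y + 1 either cancels the sum (when G 0 holds) or halves the block.
character-sum-vanishes : ∀ m {L} G a → m ℕ.≤ L → ∃ (λ l → l ℕ.< m × G l ≡ true) →
  ∑< (2 ^ m) (λ i → sign (dot L G (a ℕ.* 2 ^ m ℕ.+ i))) ≡ 0ℚ
character-sum-vanishes zero    G a _ (_ , () , _)
character-sum-vanishes (suc m) {suc L} G a (s≤s m≤L) (l , l<1+m , Gl) = begin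
  ∑< (2 ℕ.* 2 ^ m) f                                            ≡⟨ ∑<-pairs (2 ^ m) f ⟩
  ∑< (2 ^ m) (λ i → f (2 ℕ.* i) + f (suc (2 ℕ.* i)))            ≡⟨ cong ∑ (map-cong pair (upTo (2 ^ m))) ⟩
  ∑< (2 ^ m) (λ i → sign (Y i) + sign (G 0 xor Y i))            ≡⟨ by-G0 (G 0) refl ⟩
  0ℚ                                                            ∎
  where
  open ≡-Reasoning
  f = λ i → sign (dot (suc L) G (a ℕ.* 2 ^ suc m ℕ.+ i))
  Y = λ i → dot L (G ∘ suc) (a ℕ.* 2 ^ m ℕ.+ i)
  double-index : ∀ a p i → a ℕ.* (2 ℕ.* p) ℕ.+ 2 ℕ.* i ≡ (a ℕ.* p ℕ.+ i) ℕ.+ (a ℕ.* p ℕ.+ i)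
  double-index = solve-∀
  index : ∀ i → a ℕ.* 2 ^ suc m ℕ.+ 2 ℕ.* i ≡ (a ℕ.* 2 ^ m ℕ.+ i) ℕ.+ (a ℕ.* 2 ^ m ℕ.+ i)
  index = double-index a (2 ^ m)
  index+1 : ∀ i → a ℕ.* 2 ^ suc m ℕ.+ suc (2 ℕ.* i) ≡ suc ((a ℕ.* 2 ^ m ℕ.+ i) ℕ.+ (a ℕ.* 2 ^ m ℕ.+ i))
  index+1 i = trans (ℕ.+-suc (a ℕ.* 2 ^ suc m) (2 ℕ.* i)) (cong suc (index i))
  pair : ∀ i → f (2 ℕ.* i) + f (suc (2 ℕ.* i)) ≡ sign (Y i) + sign (G 0 xor Y i)
  pair i = cong₂ (λ x y → sign x + sign y)
    (trans (cong (dot (suc L) G) (index i)) (dot-double L G _))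
    (trans (cong (dot (suc L) G) (index+1 i)) (dot-double+1 L G _))
  by-G0 : ∀ b → G 0 ≡ b → ∑< (2 ^ m) (λ i → sign (Y i) + sign (b xor Y i)) ≡ 0ℚ
  by-G0 true  _   = trans (cong ∑ (map-cong (sign-cancel ∘ Y) (upTo (2 ^ m)))) (∑-map-zero (upTo (2 ^ m)))
  by-G0 false G0≡false = begin
    ∑< (2 ^ m) (λ i → sign (Y i) + sign (Y i))   ≡⟨ ∑-map-+ (sign ∘ Y) (sign ∘ Y) (upTo (2 ^ m)) ⟩
    ∑< (2 ^ m) (sign ∘ Y) + ∑< (2 ^ m) (sign ∘ Y) ≡⟨ cong₂ _+_ half half ⟩
    0ℚ + 0ℚ                                        ≡⟨ +-identityʳ 0ℚ ⟩
    0ℚ                                             ∎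
    where
    shifted : ∀ {l} → l ℕ.< suc m → G l ≡ true → ∃ (λ l′ → l′ ℕ.< m × G (suc l′) ≡ true)
    shifted {zero}   _          G0≡true with () ← trans (sym G0≡true) G0≡false
    shifted {suc l′} (s≤s l′<m) Gl′     = l′ , l′<m , Gl′
    half = character-sum-vanishes m (G ∘ suc) a m≤L (shifted l<1+m Gl)

Order2Support : ∀ {s} → Mats s → Set
Order2Support {s} C = (j : Fin s) (k l : ℕ) → 2 ℕ.* l ℕ.< k → C j k l ≡ false

all≡false⇒∃ : ∀ {A : Set} (p : A → Bool) xs → all p xs ≡ false → ∃ λ x → x ∈ xs × p x ≡ false
all≡false⇒∃ p (x ∷ xs) all≡false with p x in px
... | false = x , here refl , px
... | true with all≡false⇒∃ p xs all≡false
...   | y , y∈xs , py = y , there y∈xs , py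

-- Digits of k_j beyond 2m only meet entries c_{j,r,l} with r > 2l, which vanish.
coefficient-truncate : ∀ {s} {C : Mats s} → Order2Support C → ∀ j k {l m} → l ℕ.< m →
  F₂.∑< (2 ℕ.* m) (λ r → bit k r ∧ C j (suc r) (suc l)) ≡ coefficient C j k l
coefficient-truncate {C = C} support j k {l} {m} l<m with ℕ.≤-total k (2 ℕ.* m)
... | inj₁ k≤2m = sym (F₂.∑<-extend _ (λ {r} k≤r → cong (_∧ C j (suc r) (suc l)) (bit-beyond k r k≤r)) k≤2m)
... | inj₂ 2m≤k = F₂.∑<-extend _ vanishes 2m≤k
  where
  vanishes : ∀ {r} → 2 ℕ.* m ℕ.≤ r → bit k r ∧ C j (suc r) (suc l) ≡ false
  vanishes {r} 2m≤r = trans (cong (bit k r ∧_) (support j (suc r) (suc l) (s≤s (ℕ.≤-trans (ℕ.*-monoʳ-≤ 2 l<m) 2m≤r))))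
                            (∧-zeroʳ (bit k r))

∉dual⇒syndrome-nonzero : ∀ {s} {C : Mats s} → Order2Support C → ∀ m k → inDualB C m k ≡ false →
  ∃ λ l → l ℕ.< m × syndrome C k l ≡ true
∉dual⇒syndrome-nonzero {s} {C} support m k k∉D with all≡false⇒∃ _ (map suc (upTo m)) k∉D
... | x , x∈ , px with ∈-map⁻ suc x∈
...   | l , l∈ , refl = l , ∈-upTo⁻ l∈ , trans (sym equation) (not≡false⇒true px)
  where
  open ≡-Reasoning
  js = toList (allFin s)
  column : Fin s → List Bool
  column j = map (λ r → bit (lookup k j) r ∧ C j (suc r) (suc l)) (upTo (2 ℕ.* m))
  not≡false⇒true : ∀ {b} → not b ≡ false → b ≡ true
  not≡false⇒true {true} _ = refl
  equation : F₂.∑ (concat (toList (tabulate column))) ≡ syndrome C k l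
  equation = begin
    F₂.∑ (concat (toList (tabulate column)))
      ≡⟨ F₂.∑-concat (toList (tabulate column)) ⟩
    F₂.∑ (map F₂.∑ (toList (tabulate column))) ≡⟨ cong (F₂.∑ ∘ map F₂.∑) (toList-tabulate column) ⟩
    F₂.∑ (map F₂.∑ (map column js))
      ≡⟨ cong F₂.∑ (map-∘ js) ⟨
    F₂.∑ (map (F₂.∑ ∘ column) js)
      ≡⟨ cong F₂.∑ (map-cong (λ j → coefficient-truncate support j (lookup k j) (∈-upTo⁻ l∈)) js) ⟩
    syndrome C k l ∎

^-∣-^ : ∀ b {m n} → m ℕ.≤ n → b ^ m ℕ.∣ b ^ n
^-∣-^ b {m} {n} m≤n = ℕ.divides (b ^ (n ℕ.∸ m))
  (trans (cong (b ^_) (sym (ℕ.m∸n+n≡m m≤n))) (ℕ.^-distribˡ-+-* b (n ℕ.∸ m) m))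

n<2^n : ∀ n → n ℕ.< 2 ^ n
n<2^n zero    = s≤s z≤n
n<2^n (suc n) = ℕ.+-mono-≤ (ℕ.m^n>0 2 n) (ℕ.≤-trans (n<2^n n) (ℕ.m≤m+n (2 ^ n) 0))

blockBound : ∀ {s} → Mats s → Vec ℕ s → ℕ → ℚ
blockBound C k m = if inDualStarB C m k then ℤ.+ 2 ^ m Q./ 1 else 0ℚ

∣block-sum∣≤blockBound : ∀ {s} {C : Mats s} → Order2Support C → ∀ k → isZeroVecB k ≡ false →
  ∀ {L} m P → 2 ^ m ℕ.∣ P → P ℕ.+ 2 ^ m ℕ.≤ L →
  ∣ ∑< (2 ^ m) (λ i → sign (dot L (syndrome C k) (P ℕ.+ i))) ∣ ≤ blockBound C k m
∣block-sum∣≤blockBound {C = C} support k k≢0 {L} m P 2^m∣P P+2^m≤L with inDualB C m k in k∈D | 2^m∣P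
... | true  | _ rewrite k≢0 = ∣∑<∣≤n (2 ^ m) _ (λ i → ∣sign∣≡1 (dot L (syndrome C k) (P ℕ.+ i)))
... | false | ℕ.divides-refl a = ≤-reflexive (cong ∣_∣ (character-sum-vanishes m (syndrome C k) a m≤L
                                  (∉dual⇒syndrome-nonzero support m k k∈D)))
  where m≤L = ℕ.≤-trans (ℕ.<⇒≤ (n<2^n m)) (ℕ.≤-trans (ℕ.m≤n+m (2 ^ m) P) P+2^m≤L)

-- Each block 2^{m_h} starts at 2^{m_1} + ⋯ + 2^{m_{h-1}}, a multiple of 2^{m_h}.
∣∑<∣-dyadic : ∀ (f : ℕ → ℚ) (B : ℕ → ℚ) L →
  (∀ m P → 2 ^ m ℕ.∣ P → P ℕ.+ 2 ^ m ℕ.≤ L → ∣ ∑< (2 ^ m) (λ i → f (P ℕ.+ i)) ∣ ≤ B m) →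
  ∀ {ms} P → AllPairs ℕ._>_ ms → All (λ m → 2 ^ m ℕ.∣ P) ms → P ℕ.+ sum (map (2 ^_) ms) ℕ.≤ L →
  ∣ ∑< (sum (map (2 ^_) ms)) (λ i → f (P ℕ.+ i)) ∣ ≤ ∑ (map B ms)
∣∑<∣-dyadic f B L block {[]}     P _ _ _ = ≤-refl
∣∑<∣-dyadic f B L block {m ∷ ms} P (m>ms ∷ ordered) (2^m∣P ∷ aligned) ≤L = begin
  ∣ ∑< (2 ^ m ℕ.+ n) (λ i → f (P ℕ.+ i)) ∣
    ≡⟨ cong ∣_∣ (∑<-split (2 ^ m) n (λ i → f (P ℕ.+ i))) ⟩
  ∣ first + ∑< n (λ i → f (P ℕ.+ (2 ^ m ℕ.+ i))) ∣
    ≡⟨ cong (λ r → ∣ first + r ∣) (cong ∑ (map-cong reassoc (upTo n))) ⟩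
  ∣ first + rest ∣
    ≤⟨ ∣p+q∣≤∣p∣+∣q∣ first rest ⟩
  ∣ first ∣ + ∣ rest ∣
    ≤⟨ +-mono-≤ first≤ rest≤ ⟩
  B m + ∑ (map B ms) ∎
  where
  open ≤-Reasoning
  n = sum (map (2 ^_) ms)
  first = ∑< (2 ^ m) (λ i → f (P ℕ.+ i))
  rest = ∑< n (λ i → f (P ℕ.+ 2 ^ m ℕ.+ i))
  reassoc : ∀ i → f (P ℕ.+ (2 ^ m ℕ.+ i)) ≡ f (P ℕ.+ 2 ^ m ℕ.+ i)
  reassoc i = cong f (sym (ℕ.+-assoc P (2 ^ m) i))
  aligned′ : All (λ m′ → 2 ^ m′ ℕ.∣ P ℕ.+ 2 ^ m) ms
  aligned′ = All.zipWith (λ (m′<m , 2^m′∣P) → ℕ.∣m∣n⇒∣m+n 2^m′∣P (^-∣-^ 2 (ℕ.<⇒≤ m′<m))) (m>ms , aligned)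
  first≤ = block m P 2^m∣P (ℕ.≤-trans (ℕ.+-monoʳ-≤ P (ℕ.m≤m+n (2 ^ m) n)) ≤L)
  rest≤ = ∣∑<∣-dyadic f B L block (P ℕ.+ 2 ^ m) ordered aligned′
            (ℕ.≤-trans (ℕ.≤-reflexive (ℕ.+-assoc P (2 ^ m) n)) ≤L)

0≤inv : ∀ N → 0ℚ ≤ inv N
0≤inv zero    = ≤-refl
0≤inv (suc n) = nonNegative⁻¹ (inv (suc n)) {{normalize-nonNeg 1 (suc n)}}

∣avgWal∣≤ : ∀ {s} {C : Mats s} → Order2Support C → ∀ k → isZeroVecB k ≡ false →
  ∀ {N ms} → Linked ℕ._>_ ms → N ≡ sum (map (2 ^_) ms) →
  ∣ avgWal C N k ∣ ≤ inv N * ∑ (map (blockBound C k) ms)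
∣avgWal∣≤ {C = C} support k k≢0 {N} {ms} ordered N≡ = begin
  ∣ inv N * ∑< N (wal C k) ∣
    ≡⟨ ∣p*q∣≡∣p∣*∣q∣ (inv N) _ ⟩
  ∣ inv N ∣ * ∣ ∑< N (wal C k) ∣
    ≡⟨ cong₂ _*_ (0≤p⇒∣p∣≡p (0≤inv N)) (cong ∣_∣ wal-as-character) ⟩
  inv N * ∣ ∑< N (λ i → sign (dot N (syndrome C k) i)) ∣
    ≤⟨ *-monoˡ-≤-0≤ (0≤inv N) (subst (λ n → ∣ ∑< n _ ∣ ≤ ∑ (map (blockBound C k) ms)) (sym N≡) blocks) ⟩
  inv N * ∑ (map (blockBound C k) ms) ∎
  where
  open ≤-Reasoning
  wal-as-character = ∑<-cong N (λ i<N → wal≡sign-dot C k (ℕ.<⇒≤ i<N))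
  blocks = ∣∑<∣-dyadic (λ i → sign (dot N (syndrome C k) i)) (blockBound C k) N
             (∣block-sum∣≤blockBound support k k≢0) 0 (Linked⇒AllPairs (flip ℕ.<-trans) ordered)
             (All.universal (λ m → (2 ^ m) ℕ.∣0) ms) (ℕ.≤-reflexive (sym N≡))

-- Nonvanishing of the shifted indices

any≡true : ∀ {A : Set} (p : A → Bool) {x xs} → x ∈ xs → p x ≡ true → any p xs ≡ true
any≡true p {xs = y ∷ ys} (here refl) px = cong (_∨ any p ys) px
any≡true p {xs = y ∷ ys} (there x∈ys) px = trans (cong (p y ∨_) (any≡true p x∈ys px)) (∨-zeroʳ (p y))

zeroOrPow2-2^ : ∀ e → zeroOrPow2 (2 ^ e) ≡ true
zeroOrPow2-2^ e = trans (cong ((2 ^ e ≡ᵇ 0) ∨_) found) (∨-zeroʳ (2 ^ e ≡ᵇ 0))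
  where
  found = any≡true (λ e′ → 2 ^ e′ ≡ᵇ 2 ^ e) (∈-upTo⁺ (ℕ.m≤n⇒m≤1+n (n<2^n e)))
                   (Equivalence.to T-≡ (ℕ.≡⇒≡ᵇ (2 ^ e) (2 ^ e) refl))

μ₁-2^ : ∀ e → μ₁ (2 ^ e) ≡ suc e
μ₁-2^ e with 2 ^ e | ℕ.m^n>0 2 e | ⌊log₂[2^n]⌋≡n e
... | suc p | _ | log≡e = cong suc log≡e

shiftEntry-suc≢0 : ∀ w ℓ → shiftEntry (suc w) ℓ ≢ 0
shiftEntry-suc≢0 w ℓ shift≡0 = ℕ.<-irrefl μ₁ℓ≡ (s≤s (ℕ.m≤n+m (μ₁ ℓ) w))
  where
  μ₁ℓ≡ : μ₁ ℓ ≡ suc (w ℕ.+ μ₁ ℓ)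
  μ₁ℓ≡ = trans (cong μ₁ (⊕≡0⇒≡ ℓ _ shift≡0)) (μ₁-2^ (w ℕ.+ μ₁ ℓ))

shiftEntry-zero≢0 : ∀ ℓ → zeroOrPow2 ℓ ≡ false → shiftEntry 0 ℓ ≢ 0
shiftEntry-zero≢0 (suc n) not-pow shift≡0 with ⊕≡0⇒≡ (suc n) _ shift≡0
... | ℓ≡2^e with () ← trans (sym not-pow) (trans (cong zeroOrPow2 ℓ≡2^e) (zeroOrPow2-2^ ⌊log₂ suc n ⌋))

HasSupport : ∀ {s} → Vec Bool s → Vec ℕ s → Set
HasSupport []          []      = ⊤
HasSupport (true  ∷ u) (z ∷ v) = z ≢ 0 × HasSupport u v
HasSupport (false ∷ u) (z ∷ v) = z ≡ 0 × HasSupport u v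

private
  ≢0⇒≡ᵇ0≡false : ∀ {n} → n ≢ 0 → (n ≡ᵇ 0) ≡ false
  ≢0⇒≡ᵇ0≡false {zero}  n≢0 = contradiction refl n≢0
  ≢0⇒≡ᵇ0≡false {suc n} _   = refl

shiftIdx-nonzero : ∀ {s} (u : Vec Bool s) ℓ z → T (inA ℓ u) → HasSupport u z → isZeroVecB (shiftIdx z ℓ) ≡ false
shiftIdx-nonzero []          []      []      ()
shiftIdx-nonzero (true  ∷ u) (x ∷ ℓ) (zero  ∷ z) _ (z≢0 , _) = contradiction refl z≢0
shiftIdx-nonzero (true  ∷ u) (x ∷ ℓ) (suc w ∷ z) _ _ rewrite ≢0⇒≡ᵇ0≡false (shiftEntry-suc≢0 w x) = refl
shiftIdx-nonzero (false ∷ u) (x ∷ ℓ) (.0 ∷ z) u∈A (refl , supp) with zeroOrPow2 x in x-pow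
... | false rewrite ≢0⇒≡ᵇ0≡false (shiftEntry-zero≢0 x x-pow) = refl
... | true  rewrite shiftIdx-nonzero u ℓ z u∈A supp = ∧-zeroʳ _

-- Bounding c(ℓ)

half^-nonNeg : ∀ e → 0ℚ ≤ half^ e
half^-nonNeg zero    = nonNegative⁻¹ 1ℚ
half^-nonNeg (suc e) = 0≤p*q (nonNegative⁻¹ ½) (half^-nonNeg e)

half^≤1 : ∀ e → half^ e ≤ 1ℚ
half^≤1 zero    = ≤-refl
half^≤1 (suc e) = ≤-trans (*-monoˡ-≤-0≤ (nonNegative⁻¹ ½) (half^≤1 e)) (<⇒≤ (Q.*<* (ℤ.+<+ (s≤s (s≤s z≤n)))))

half^-antitone : ∀ e d → half^ (e ℕ.+ d) ≤ half^ e
half^-antitone zero    d = half^≤1 d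
half^-antitone (suc e) d = *-monoˡ-≤-0≤ (nonNegative⁻¹ ½) (half^-antitone e d)

μ₁v≡∣b∣₁ : ∀ {s} (b ℓ : Vec ℕ s) → InB b ℓ → μ₁v ℓ ≡ ∣ b ∣₁
μ₁v≡∣b∣₁ []      []      _   = refl
μ₁v≡∣b∣₁ (_ ∷ b) (_ ∷ ℓ) ℓ∈B = cong₂ ℕ._+_ (ℓ∈B Fin.zero) (μ₁v≡∣b∣₁ b ℓ (ℓ∈B ∘ Fin.suc))

∣signU∣≡1 : ∀ e → ∣ signU e ∣ ≡ 1ℚ
∣signU∣≡1 zero    = refl
∣signU∣≡1 (suc e) = trans (∣-p∣≡∣p∣ (signU e)) (∣signU∣≡1 e)

blockBound-nonNeg : ∀ {s} (C : Mats s) k m → 0ℚ ≤ blockBound C k m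
blockBound-nonNeg C k m with inDualStarB C m k
... | true  = nonNegative⁻¹ (ℤ.+ 2 ^ m Q./ 1) {{normalize-nonNeg (2 ^ m) 1}}
... | false = ≤-refl

subsetCount : ℕ → ℚ
subsetCount s = ∑ (map (λ _ → 1ℚ) (subsets s))

subsets-nonempty : ∀ s → ∃₂ λ u us → subsets s ≡ u ∷ us
subsets-nonempty zero    = [] , [] , refl
subsets-nonempty (suc s) with subsets-nonempty s
... | u , us , eq rewrite eq = false ∷ u , _ , refl

subsetCount-pos : ∀ s → 0ℚ < subsetCount s
subsetCount-pos s with subsets-nonempty s
... | u , us , eq rewrite eq = <-≤-trans (positive⁻¹ 1ℚ) (p≤p+q (∑-map-nonNeg (λ _ → nonNegative⁻¹ 1ℚ) us))

∑-box0-suc : ∀ s K (g : Vec ℕ (suc s) → ℚ) →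
  ∑ (map g (box0 (suc s) K)) ≡ ∑ (map (g ∘ (0 ∷_)) (box0 s K)) + ∑< K (λ i → ∑ (map (g ∘ (suc i ∷_)) (box0 s K)))
∑-box0-suc s K g = begin
  ∑ (map g (box0 (suc s) K))
    ≡⟨ ∑-concatMap g (λ z → map (z ∷_) (box0 s K)) (upTo (suc K)) ⟩
  ∑< (suc K) (λ z → ∑ (map g (map (z ∷_) (box0 s K))))
    ≡⟨ cong ∑ (map-cong (λ z → cong ∑ (map-∘ (box0 s K))) (upTo (suc K))) ⟨
  ∑< (suc K) (λ z → ∑ (map (g ∘ (z ∷_)) (box0 s K)))
    ≡⟨ ∑<-suc K (λ z → ∑ (map (g ∘ (z ∷_)) (box0 s K))) ⟩
  ∑ (map (g ∘ (0 ∷_)) (box0 s K)) + ∑< K (λ i → ∑ (map (g ∘ (suc i ∷_)) (box0 s K))) ∎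
  where open ≡-Reasoning

∑-boxU≤∑-box0 : ∀ {s} (u : Vec Bool s) K {f g : Vec ℕ s → ℚ} →
  (∀ z → HasSupport u z → f z ≤ g z) → (∀ z → 0ℚ ≤ g z) → ∑ (map f (boxU u K)) ≤ ∑ (map g (box0 s K))
∑-boxU≤∑-box0 []          K f≤g _   = +-monoˡ-≤ 0ℚ (f≤g [] _)
∑-boxU≤∑-box0 {suc s} (false ∷ u) K {f} {g} f≤g 0≤g = begin
  ∑ (map f (map (0 ∷_) (boxU u K)))
    ≡⟨ cong ∑ (map-∘ (boxU u K)) ⟨
  ∑ (map (f ∘ (0 ∷_)) (boxU u K))
    ≤⟨ ∑-boxU≤∑-box0 u K (λ z supp → f≤g (0 ∷ z) (refl , supp)) (0≤g ∘ (0 ∷_)) ⟩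
  ∑ (map (g ∘ (0 ∷_)) (box0 s K))
    ≤⟨ p≤p+q (∑-map-nonNeg (λ i → ∑-map-nonNeg (0≤g ∘ (suc i ∷_)) (box0 s K)) (upTo K)) ⟩
  _
    ≡⟨ ∑-box0-suc s K g ⟨
  ∑ (map g (box0 (suc s) K)) ∎
  where open ≤-Reasoning
∑-boxU≤∑-box0 {suc s} (true ∷ u) K {f} {g} f≤g 0≤g = begin
  ∑ (map f (boxU (true ∷ u) K))
    ≡⟨ ∑-concatMap f (λ z → map (z ∷_) (boxU u K)) (map suc (upTo K)) ⟩
  ∑ (map (λ z → ∑ (map f (map (z ∷_) (boxU u K)))) (map suc (upTo K)))
    ≡⟨ cong ∑ (trans (sym (map-∘ (upTo K))) (map-cong (λ i → cong ∑ (sym (map-∘ (boxU u K)))) (upTo K))) ⟩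
  ∑< K (λ i → ∑ (map (f ∘ (suc i ∷_)) (boxU u K)))
    ≤⟨ ∑-map-mono (All.universal slice≤ (upTo K)) ⟩
  ∑< K (λ i → ∑ (map (g ∘ (suc i ∷_)) (box0 s K)))
    ≤⟨ p≤q+p (∑-map-nonNeg (0≤g ∘ (0 ∷_)) (box0 s K)) ⟩
  _ ≡⟨ ∑-box0-suc s K g ⟨
  ∑ (map g (box0 (suc s) K)) ∎
  where
  open ≤-Reasoning
  slice≤ : ∀ i → ∑ (map (f ∘ (suc i ∷_)) (boxU u K)) ≤ ∑ (map (g ∘ (suc i ∷_)) (box0 s K))
  slice≤ i = ∑-boxU≤∑-box0 u K (λ z supp → f≤g (suc i ∷ z) ((λ ()) , supp)) (0≤g ∘ (suc i ∷_))

module _ {s} {C : Mats s} (support : Order2Support C) {N ms} (ordered : Linked ℕ._>_ ms)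
         (N≡ : N ≡ sum (map (2 ^_) ms)) (b ℓ : Vec ℕ s) (ℓ∈B : InB b ℓ) (K : ℕ) where

  averageBound : Vec ℕ s → ℚ
  averageBound z = inv N * ∑ (map (blockBound C (shiftIdx z ℓ)) ms)

  averageBound-nonNeg : ∀ z → 0ℚ ≤ averageBound z
  averageBound-nonNeg z = 0≤p*q (0≤inv N) (∑-map-nonNeg (blockBound-nonNeg C (shiftIdx z ℓ)) ms)

  summandBound : Vec ℕ s → ℚ
  summandBound z = half^ (∣ b ∣₁ ℕ.+ ∣ z ∣₁) * averageBound z

  summandBound-nonNeg : ∀ z → 0ℚ ≤ summandBound z
  summandBound-nonNeg z = 0≤p*q (half^-nonNeg (∣ b ∣₁ ℕ.+ ∣ z ∣₁)) (averageBound-nonNeg z)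

  ∣summand∣≤summandBound : ∀ u z → T (inA ℓ u) → HasSupport u z →
    ∣ half^ (μ₁v ℓ ℕ.+ ∣ z ∣₁ ℕ.+ s) * avgWal C N (shiftIdx z ℓ) ∣ ≤ summandBound z
  ∣summand∣≤summandBound u z u∈A supp = begin
    ∣ h * avg ∣
      ≡⟨ ∣p*q∣≡∣p∣*∣q∣ h avg ⟩
    ∣ h ∣ * ∣ avg ∣
      ≡⟨ cong (_* ∣ avg ∣) (0≤p⇒∣p∣≡p h≥0) ⟩
    h * ∣ avg ∣
      ≤⟨ *-monoˡ-≤-0≤ h≥0 (∣avgWal∣≤ support (shiftIdx z ℓ) (shiftIdx-nonzero u ℓ z u∈A supp) ordered N≡) ⟩
    h * averageBound z
      ≤⟨ *-monoʳ-≤-nonNeg (averageBound z) {{Q.nonNegative (averageBound-nonNeg z)}} h≤ ⟩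
    summandBound z ∎
    where
    open ≤-Reasoning
    h = half^ (μ₁v ℓ ℕ.+ ∣ z ∣₁ ℕ.+ s)
    h≥0 = half^-nonNeg (μ₁v ℓ ℕ.+ ∣ z ∣₁ ℕ.+ s)
    avg = avgWal C N (shiftIdx z ℓ)
    h≤ : h ≤ half^ (∣ b ∣₁ ℕ.+ ∣ z ∣₁)
    h≤ = subst (λ e → half^ (e ℕ.+ ∣ z ∣₁ ℕ.+ s) ≤ half^ (∣ b ∣₁ ℕ.+ ∣ z ∣₁)) (sym (μ₁v≡∣b∣₁ b ℓ ℓ∈B))
               (half^-antitone (∣ b ∣₁ ℕ.+ ∣ z ∣₁) s)

  summandTotal : ℚ
  summandTotal = ∑ (map summandBound (box0 s K))

  subsetTerm : Vec Bool s → ℚ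
  subsetTerm u = ∑ (map (λ z → half^ (μ₁v ℓ ℕ.+ ∣ z ∣₁ ℕ.+ s) * avgWal C N (shiftIdx z ℓ)) (boxU u K))

  ∣subsetTerm∣≤ : ∀ u → T (inA ℓ u) → ∣ signU (s ℕ.∸ countU u) * subsetTerm u ∣ ≤ summandTotal
  ∣subsetTerm∣≤ u u∈A = begin
    ∣ signU (s ℕ.∸ countU u) * subsetTerm u ∣
      ≡⟨ ∣p*q∣≡∣p∣*∣q∣ (signU (s ℕ.∸ countU u)) (subsetTerm u) ⟩
    ∣ signU (s ℕ.∸ countU u) ∣ * ∣ subsetTerm u ∣
      ≡⟨ trans (cong (_* ∣ subsetTerm u ∣) (∣signU∣≡1 (s ℕ.∸ countU u))) (*-identityˡ _) ⟩
    ∣ subsetTerm u ∣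
      ≤⟨ ∣∑∣≤∑∣∣ _ (boxU u K) ⟩
    _
      ≤⟨ ∑-boxU≤∑-box0 u K (λ z → ∣summand∣≤summandBound u z u∈A) summandBound-nonNeg ⟩
    summandTotal ∎
    where open ≤-Reasoning

  ∣cPartial∣≤ : ∣ cPartial C N ℓ K ∣ ≤ subsetCount s * summandTotal
  ∣cPartial∣≤ = begin
    ∣ ∑ (map term A) ∣
      ≤⟨ ∣∑∣≤∑∣∣ term A ⟩
    ∑ (map (∣_∣ ∘ term) A)
      ≤⟨ ∑-map-mono (All.map (λ {u} → ∣subsetTerm∣≤ u) (all-filter inA? (subsets s))) ⟩
    ∑ (map (λ _ → summandTotal) A)
      ≤⟨ ∑-map-filter-≤ inA? (λ _ → summandTotal-nonNeg) (subsets s) ⟩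
    ∑ (map (λ _ → summandTotal) (subsets s))
      ≡⟨ ∑-map-const summandTotal (subsets s) ⟩
    subsetCount s * summandTotal ∎
    where
    open ≤-Reasoning
    term = λ u → signU (s ℕ.∸ countU u) * subsetTerm u
    inA? = λ u → T? (inA ℓ u)
    A = filter inA? (subsets s)
    summandTotal-nonNeg = ∑-map-nonNeg summandBound-nonNeg (box0 s K)

  rhsPartial≡summandTotal : rhsPartial C N ms b ℓ K ≡ summandTotal
  rhsPartial≡summandTotal = begin
    ∑ (map (λ m → c m * ∑ (map (e m) Z)) ms)              ≡⟨ cong ∑ (map-cong (λ m → *-∑ (c m) (e m) Z) ms) ⟩
    ∑ (map (λ m → ∑ (map (λ z → c m * e m z) Z)) ms)      ≡⟨ ∑-map-swap (λ m z → c m * e m z) ms Z ⟩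
    ∑ (map (λ z → ∑ (map (λ m → c m * e m z) ms)) Z)      ≡⟨ cong ∑ (map-cong per-z Z) ⟩
    summandTotal                                          ∎
    where
    open ≡-Reasoning
    Z = box0 s K
    c = λ m → ℤ.+ 2 ^ m Q./ 1 * inv N
    e = λ m z → if inDualStarB C m (shiftIdx z ℓ) then half^ (∣ b ∣₁ ℕ.+ ∣ z ∣₁) else 0ℚ
    per-z : ∀ z → ∑ (map (λ m → c m * e m z) ms) ≡ summandBound z
    per-z z = begin
      ∑ (map (λ m → c m * e m z) ms)               ≡⟨ cong ∑ (map-cong scale ms) ⟩
      ∑ (map (λ m → h * (inv N * bb m)) ms)        ≡⟨ *-∑ h (λ m → inv N * bb m) ms ⟨
      h * ∑ (map (λ m → inv N * bb m) ms)          ≡⟨ cong (h *_) (*-∑ (inv N) bb ms) ⟨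
      h * (inv N * ∑ (map bb ms))                  ∎
      where
      h = half^ (∣ b ∣₁ ℕ.+ ∣ z ∣₁)
      bb = blockBound C (shiftIdx z ℓ)
      scale : ∀ m → c m * e m z ≡ h * (inv N * bb m)
      scale m with inDualStarB C m (shiftIdx z ℓ)
      ... | true  = trans (*-comm (c m) h) (cong (h *_) (*-comm (ℤ.+ 2 ^ m Q./ 1) (inv N)))
      ... | false = trans (*-zeroʳ (c m)) (sym (trans (cong (h *_) (*-zeroʳ (inv N))) (*-zeroʳ h)))

  ∣cPartial∣≤rhsPartial : ∣ cPartial C N ℓ K ∣ ≤ subsetCount s * rhsPartial C N ms b ℓ K
  ∣cPartial∣≤rhsPartial =
    subst (λ r → ∣ cPartial C N ℓ K ∣ ≤ subsetCount s * r) (sym rhsPartial≡summandTotal) ∣cPartial∣≤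

lemma4 : (s : ℕ) → 1 ℕ.≤ s →
    Σ ℚ (λ Cs → 0ℚ Q.< Cs ×
      ((t : ℕ) (C : Mats s) → IsOrder2Seq s t C →
       (N : ℕ) (ms : List ℕ) → Linked ℕ._>_ ms → N ≡ sum (map (2 ^_) ms) → 2 ℕ.≤ N →
       (b ℓ : Vec ℕ s) → InB b ℓ →
       (ε : ℚ) → 0ℚ Q.< ε →
       ∃ (λ K₀ → (K : ℕ) → K₀ ℕ.≤ K →
         ∣ cPartial C N ℓ K ∣ Q.≤ (Cs Q.* rhsPartial C N ms b ℓ K) Q.+ ε)))
lemma4 s _ = subsetCount s , subsetCount-pos s ,
  λ t C order2 N ms ordered N≡ _ b ℓ ℓ∈B ε ε>0 → 0 , λ K _ →
    ≤-trans (∣cPartial∣≤rhsPartial (proj₁ order2) ordered N≡ b ℓ ℓ∈B K) (p≤p+q (<⇒≤ ε>0))
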